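{- Let $\mathcal D$ be a $\mathsf B^-$-coderivation containing no instances of $\mathsf{cond}_\Box$, $\mathsf{cond}_N$ or $\mathsf{id}$. If $|\vec x|=|\vec x'|$ and $|\vec y|=|\vec y'|$ and $[\![\mathcal D]\!](\vec x;\vec y)$ is well-defined, then $[\![\mathcal D]\!](\vec x;\vec y)=[\![\mathcal D]\!](\vec x';\vec y')$.
   Context: $|x|$ is the binary length of $x\in\mathbb N$; $|\vec x|=|\vec x'|$ means componentwise equality of lengths. Types: $N$, $\Box N$; sequents $\Gamma\Rightarrow A$ with all $\Box N$ before all $N$. Rules of $\mathsf B^-$: $\mathsf{id}$: $N\Rightarrow N$; $\mathsf{cut}_N$: from $\Gamma\Rightarrow N$, $\Gamma,N\Rightarrow B$ infer $\Gamma\Rightarrow B$; $\mathsf{cut}_\Box$: from $\Gamma\Rightarrow\Box N$, $\Box N,\Gamma\Rightarrow B$ infer $\Gamma\Rightarrow B$; $\mathsf w_N,\mathsf w_\Box$ (weakening); exchange; $\Box_l$: from $\Gamma,N\Rightarrow A$ infer $\Box N,\Gamma\Rightarrow A$; $\Box_r$: from $\Box\Gamma\Rightarrow N$ infer $\Box\Gamma\Rightarrow\Box N$; $0,1$: $\Rightarrow N$; $\mathsf s_0,\mathsf s_1$: from $\Gamma\Rightarrow A$ infer $\Gamma\Rightarrow A$; $\mathsf{cond}_N$: from $\Gamma\Rightarrow N$, $\Gamma,N\Rightarrow N$, $\Gamma,N\Rightarrow N$ infer $\Gamma,N\Rightarrow N$; $\mathsf{cond}_\Box$: from $\Gamma\Rightarrow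 N$, $\Box N,\Gamma\Rightarrow N$, $\Box N,\Gamma\Rightarrow N$ infer $\Box N,\Gamma\Rightarrow N$; $|\mathsf{cond}|_N,|\mathsf{cond}|_\Box$: same with only the first two premises. A coderivation is a possibly infinite finitely branching tree built from these rules. Semantics (node with conclusion $\Box N^m,N^n\Rightarrow A$ denotes $f(x_1..x_m;y_1..y_n)$; $f_0,f_1,f_2$ for premises; $i\in\{0,1\}$, $2z+i\neq0$): $\mathsf{id}$: $f(;y)=y$; $\mathsf{cut}_N$: $f(\vec x;\vec y)=f_1(\vec x;\vec y,f_0(\vec x;\vec y))$; $\mathsf{cut}_\Box$: $f(\vec x;\vec y)=f_1(f_0(\vec x;\vec y),\vec x;\vec y)$; weakenings ignore the new argument; exchange permutes; $\Box_l$: $f(x,\vec x;\vec y)=f_0(\vec x;\vec y,x)$; $\Box_r$: $f(\vec x;)=f_0(\vec x;)$; $0,1$ constants; $\mathsf s_i$: $f=2f_0+i$; $\mathsf{cond}_N$: $f(\vec x;\vec y,0)=f_0(\vec x;\vec y)$, $f(\vec x;\vec y,2y+i)=f_{i+1}(\vec x;\vec y,y)$; $\mathsf{cond}_\Box$: $f(0,\vec x;\vec y)=f_0(\vec x;\vec y)$, $f(2x+i,\vec x;\vec y)=f_{i+1}(x,\vec x;\vec y)$; $|\mathsf{cond}|_N$: $f(\vec x;\vec y,0)=f_0(\vec x;\vec y)$, $f(\vec x;\vec y,2y+i)=f_1(\vec x;\vec y,y)$; $|\mathsf{cond}|_\Box$: $f(0,\vec x;\vec y)=f_0(\vec x;\vec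 y)$, $f(2x+i,\vec x;\vec y)=f_1(x,\vec x;\vec y)$. $[\![\mathcal D]\!]$ is the partial function computed by this (possibly infinite) equational program; a value is well-defined when it is derivable by finite equational reasoning. -}

module Defs where

open import Data.Nat using (ℕ; zero; suc; _+_; _*_)
open import Data.Nat.Logarithm using (⌈log₂_⌉)
open import Data.Fin using (Fin)
open import Data.Vec using (Vec; []; _∷_; _∷ʳ_; lookup; _[_]≔_; map)
open import Data.List using (List; []; _∷_)
open import Data.List.Membership.Propositional using (_∈_)
open import Data.Product using (Σ; _,_)
open import Data.Unit using (⊤)
open import Data.Sum using (_⊎_)
open import Data.Empty using (⊥)
open import Relation.Binary.PropositionalEquality using (_≡_; _≢_)

-- Binary length |x| of a natural number (|0| = 0, |1| = 1, |2| = |3| = 2, ...).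
∣_∣b : ℕ → ℕ
∣ x ∣b = ⌈log₂ (suc x) ⌉

data Ty : Set where
  N  : Ty
  □N : Ty

-- A sequent  □N^m , N^n ⇒ A  is represented by the triple (m, n, A):
-- all □N's come before all N's.  "Γ , N" appends an N at the END of the
-- N-part (index suc n, value appended with _∷ʳ_); "□N , Γ" prepends a □N at
-- the FRONT of the □-part (index suc m, value prepended with _∷_).

data Rule (P : ℕ → ℕ → Ty → Set) : ℕ → ℕ → Ty → Set where
  id     : Rule P 0 1 N
  cutN   : ∀ {m n B} → P m n N → P m (suc n) B → Rule P m n B
  cut□   : ∀ {m n B} → P m n □N → P (suc m) n B → Rule P m n B
  wN     : ∀ {m n B} → P m n B → Rule P m (suc n) B
  w□     : ∀ {m n B} → P m n B → Rule P (suc m) n B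
  -- exchange of two N's / two □N's (a transposition of positions i, j)
  exN    : ∀ {m n A} → Fin n → Fin n → P m n A → Rule P m n A
  ex□    : ∀ {m n A} → Fin m → Fin m → P m n A → Rule P m n A
  □l     : ∀ {m n A} → P m (suc n) A → Rule P (suc m) n A
  □r     : ∀ {m} → P m 0 N → Rule P m 0 □N
  r0     : Rule P 0 0 N
  r1     : Rule P 0 0 N
  s0     : ∀ {m n A} → P m n A → Rule P m n A
  s1     : ∀ {m n A} → P m n A → Rule P m n A
  condN  : ∀ {m n} → P m n N → P m (suc n) N → P m (suc n) N → Rule P m (suc n) N
  cond□  : ∀ {m n} → P m n N → P (suc m) n N → P (suc m) n N → Rule P (suc m) n N
  ∣cond∣N : ∀ {m n} → P m n N → P m (suc n) N → Rule P m (suc n) N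
  ∣cond∣□ : ∀ {m n} → P m n N → P (suc m) n N → Rule P (suc m) n N

-- Coderivations (possibly infinite, finitely branching trees), presented
-- coalgebraically: a sequent-indexed set of nodes, each labelled by a rule
-- instance whose premises are again nodes; the coderivation is the tree
-- unfolded from a root node.  (Every such tree arises this way, e.g. with
-- the nodes being the positions in the tree.)
record System : Set₁ where
  field
    Pt   : ℕ → ℕ → Ty → Set
    step : ∀ {m n A} → Pt m n A → Rule Pt m n A

open System public

record CD (m n : ℕ) (A : Ty) : Set₁ where
  constructor ⟨_,_⟩
  field
    sys  : System
    root : Pt sys m n A

open CD public


swap : ∀ {k} {X : Set} → Fin k → Fin k → Vec X k → Vec X k
swap i j v = (v [ i ]≔ lookup v j) [ j ]≔ lookup v i

-- For a system S, node p and arguments xs (for the □N's) and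
-- ys (for the N's),  Sem S p xs ys v  means that the equation
-- f_p(xs ; ys) = v  is derivable by finite equational reasoning from the
-- (infinite) equational program given by the semantic clauses of the rules.
module _ (S : System) where
  private
    P = Pt S

  data Sem : ∀ {m n A} → P m n A → Vec ℕ m → Vec ℕ n → ℕ → Set where
    ev-id   : ∀ {p : P 0 1 N} {y} → step S p ≡ id → Sem p [] (y ∷ []) y
    ev-cutN : ∀ {m n B} {p : P m n B} {p₀ p₁ xs ys v₀ v} → step S p ≡ cutN p₀ p₁ →
              Sem p₀ xs ys v₀ → Sem p₁ xs (ys ∷ʳ v₀) v → Sem p xs ys v
    ev-cut□ : ∀ {m n B} {p : P m n B} {p₀ p₁ xs ys v₀ v} → step S p ≡ cut□ p₀ p₁ →
              Sem p₀ xs ys v₀ → Sem p₁ (v₀ ∷ xs) ys v → Sem p xs ys v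
    ev-wN   : ∀ {m n B} {p : P m (suc n) B} {p₀ xs ys y v} → step S p ≡ wN p₀ →
              Sem p₀ xs ys v → Sem p xs (ys ∷ʳ y) v
    ev-w□   : ∀ {m n B} {p : P (suc m) n B} {p₀ xs ys x v} → step S p ≡ w□ p₀ →
              Sem p₀ xs ys v → Sem p (x ∷ xs) ys v
    ev-exN  : ∀ {m n A} {p : P m n A} {i j p₀ xs ys v} → step S p ≡ exN i j p₀ →
              Sem p₀ xs (swap i j ys) v → Sem p xs ys v
    ev-ex□  : ∀ {m n A} {p : P m n A} {i j p₀ xs ys v} → step S p ≡ ex□ i j p₀ →
              Sem p₀ (swap i j xs) ys v → Sem p xs ys v
    ev-□l   : ∀ {m n A} {p : P (suc m) n A} {p₀ x xs ys v} → step S p ≡ □l p₀ →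
              Sem p₀ xs (ys ∷ʳ x) v → Sem p (x ∷ xs) ys v
    ev-□r   : ∀ {m} {p : P m 0 □N} {p₀ xs v} → step S p ≡ □r p₀ →
              Sem p₀ xs [] v → Sem p xs [] v
    ev-0    : ∀ {p : P 0 0 N} → step S p ≡ r0 → Sem p [] [] 0
    ev-1    : ∀ {p : P 0 0 N} → step S p ≡ r1 → Sem p [] [] 1
    ev-s0   : ∀ {m n A} {p : P m n A} {p₀ xs ys v} → step S p ≡ s0 p₀ →
              Sem p₀ xs ys v → Sem p xs ys (2 * v)
    ev-s1   : ∀ {m n A} {p : P m n A} {p₀ xs ys v} → step S p ≡ s1 p₀ →
              Sem p₀ xs ys v → Sem p xs ys (2 * v + 1)
    ev-condN-ε : ∀ {m n} {p : P m (suc n) N} {p₀ p₁ p₂ xs ys v} → step S p ≡ condN p₀ p₁ p₂ →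
              Sem p₀ xs ys v → Sem p xs (ys ∷ʳ 0) v
    ev-condN-0 : ∀ {m n} {p : P m (suc n) N} {p₀ p₁ p₂ xs ys y z v} → step S p ≡ condN p₀ p₁ p₂ →
              z ≡ 2 * y + 0 → z ≢ 0 →
              Sem p₁ xs (ys ∷ʳ y) v → Sem p xs (ys ∷ʳ z) v
    ev-condN-1 : ∀ {m n} {p : P m (suc n) N} {p₀ p₁ p₂ xs ys y z v} → step S p ≡ condN p₀ p₁ p₂ →
              z ≡ 2 * y + 1 → z ≢ 0 →
              Sem p₂ xs (ys ∷ʳ y) v → Sem p xs (ys ∷ʳ z) v
    ev-cond□-ε : ∀ {m n} {p : P (suc m) n N} {p₀ p₁ p₂ xs ys v} → step S p ≡ cond□ p₀ p₁ p₂ →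
              Sem p₀ xs ys v → Sem p (0 ∷ xs) ys v
    ev-cond□-0 : ∀ {m n} {p : P (suc m) n N} {p₀ p₁ p₂ xs ys x z v} → step S p ≡ cond□ p₀ p₁ p₂ →
              z ≡ 2 * x + 0 → z ≢ 0 →
              Sem p₁ (x ∷ xs) ys v → Sem p (z ∷ xs) ys v
    ev-cond□-1 : ∀ {m n} {p : P (suc m) n N} {p₀ p₁ p₂ xs ys x z v} → step S p ≡ cond□ p₀ p₁ p₂ →
              z ≡ 2 * x + 1 → z ≢ 0 →
              Sem p₂ (x ∷ xs) ys v → Sem p (z ∷ xs) ys v
    ev-∣condN∣-ε : ∀ {m n} {p : P m (suc n) N} {p₀ p₁ xs ys v} → step S p ≡ ∣cond∣N p₀ p₁ →
              Sem p₀ xs ys v → Sem p xs (ys ∷ʳ 0) v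
    ev-∣condN∣-s : ∀ {m n} {p : P m (suc n) N} {p₀ p₁ xs ys y i z v} → step S p ≡ ∣cond∣N p₀ p₁ →
              (i ≡ 0 ⊎ i ≡ 1) → z ≡ 2 * y + i → z ≢ 0 →
              Sem p₁ xs (ys ∷ʳ y) v → Sem p xs (ys ∷ʳ z) v
    ev-∣cond□∣-ε : ∀ {m n} {p : P (suc m) n N} {p₀ p₁ xs ys v} → step S p ≡ ∣cond∣□ p₀ p₁ →
              Sem p₀ xs ys v → Sem p (0 ∷ xs) ys v
    ev-∣cond□∣-s : ∀ {m n} {p : P (suc m) n N} {p₀ p₁ xs ys x i z v} → step S p ≡ ∣cond∣□ p₀ p₁ →
              (i ≡ 0 ⊎ i ≡ 1) → z ≡ 2 * x + i → z ≢ 0 →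
              Sem p₁ (x ∷ xs) ys v → Sem p (z ∷ xs) ys v

  Node : Set
  Node = Σ ℕ λ m → Σ ℕ λ n → Σ Ty λ A → P m n A

  pack : ∀ {m n A} → P m n A → Node
  pack {m} {n} {A} p = m , n , A , p

  premises : ∀ {m n A} → Rule P m n A → List Node
  premises id = []
  premises (cutN p₀ p₁) = pack p₀ ∷ pack p₁ ∷ []
  premises (cut□ p₀ p₁) = pack p₀ ∷ pack p₁ ∷ []
  premises (wN p₀) = pack p₀ ∷ []
  premises (w□ p₀) = pack p₀ ∷ []
  premises (exN _ _ p₀) = pack p₀ ∷ []
  premises (ex□ _ _ p₀) = pack p₀ ∷ []
  premises (□l p₀) = pack p₀ ∷ []
  premises (□r p₀) = pack p₀ ∷ []
  premises r0 = []
  premises r1 = []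
  premises (s0 p₀) = pack p₀ ∷ []
  premises (s1 p₀) = pack p₀ ∷ []
  premises (condN p₀ p₁ p₂) = pack p₀ ∷ pack p₁ ∷ pack p₂ ∷ []
  premises (cond□ p₀ p₁ p₂) = pack p₀ ∷ pack p₁ ∷ pack p₂ ∷ []
  premises (∣cond∣N p₀ p₁) = pack p₀ ∷ pack p₁ ∷ []
  premises (∣cond∣□ p₀ p₁) = pack p₀ ∷ pack p₁ ∷ []

  data Reach : Node → Node → Set where
    here  : ∀ {q} → Reach q q
    there : ∀ {m n A} {p : P m n A} {q r} →
            q ∈ premises (step S p) → Reach q r → Reach (pack p) r

⟦_⟧_⨾_≔_ : ∀ {m n A} → CD m n A → Vec ℕ m → Vec ℕ n → ℕ → Set
⟦ D ⟧ xs ⨾ ys ≔ v = Sem (sys D) (root D) xs ys v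

Allowed : ∀ {P m n A} → Rule P m n A → Set
Allowed id = ⊥
Allowed (condN _ _ _) = ⊥
Allowed (cond□ _ _ _) = ⊥
Allowed _ = ⊤

NoCondId : ∀ {m n A} → CD m n A → Set
NoCondId D = ∀ {m' n' A'} {p : Pt (sys D) m' n' A'} →
             Reach (sys D) (pack (sys D) (root D)) (pack (sys D) p) → Allowed (step (sys D) p)

SameLen : ∀ {k} → Vec ℕ k → Vec ℕ k → Set
SameLen xs xs' = map ∣_∣b xs ≡ map ∣_∣b xs'

-- Only the conditional rules look at their arguments, and the |cond| rules
-- only ask whether z = 0 and pass on ⌊z/2⌋.  Both depend on |z| alone:
-- |z| = 0 iff z = 0, and |⌊z/2⌋| = |z| ∸ 1.  Every other rule moves its
-- arguments around or feeds in the value of a subcomputation, which is the same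
-- for length-equal inputs by induction.  (The rules id, cond_N and cond_□
-- break this: the first returns its argument, the others branch on its parity.)
module Submission where

open import Defs
open import Data.Nat using (ℕ; zero; suc; _+_; _*_; _∸_; z≤n; s≤s; ⌊_/2⌋)
open import Data.Nat.Properties using (+-suc; ≤-trans; ≤-reflexive)
open import Data.Nat.Logarithm using (⌈log₂⌉-mono-≤; ⌈log₂⌈n/2⌉⌉≡⌈log₂n⌉∸1)
open import Data.Fin using (Fin)
open import Data.Vec using (Vec; []; _∷_; _∷ʳ_; lookup; _[_]≔_; map; initLast)
open import Data.Vec.Properties using (map-∷ʳ; ∷ʳ-injective; ∷-injective; map-[]≔; lookup-map)
open import Data.List using (_∷_)
open import Data.List.Membership.Propositional using (_∈_)
open import Data.List.Relation.Unary.Any using (here; there)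
open import Data.Product using (Σ; ∃₂; _×_; _,_; proj₁; proj₂)
open import Data.Sum using (_⊎_; inj₁; inj₂)
open import Data.Empty using (⊥-elim)
open import Relation.Binary.PropositionalEquality
  using (_≡_; _≢_; refl; sym; trans; cong; cong₂; module ≡-Reasoning)

⌊2*n+i/2⌋≡n : ∀ n {i} → (i ≡ 0 ⊎ i ≡ 1) → ⌊ 2 * n + i /2⌋ ≡ n
⌊2*n+i/2⌋≡n zero    (inj₁ refl) = refl
⌊2*n+i/2⌋≡n zero    (inj₂ refl) = refl
⌊2*n+i/2⌋≡n (suc n) {i} bit =
  trans (cong (λ k → ⌊ suc k + i /2⌋) (+-suc n (n + 0))) (cong suc (⌊2*n+i/2⌋≡n n bit))

n≡2*⌊n/2⌋+parity : ∀ n → Σ ℕ λ i → (i ≡ 0 ⊎ i ≡ 1) × n ≡ 2 * ⌊ n /2⌋ + i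
n≡2*⌊n/2⌋+parity zero          = 0 , inj₁ refl , refl
n≡2*⌊n/2⌋+parity (suc zero)    = 1 , inj₂ refl , refl
n≡2*⌊n/2⌋+parity (suc (suc n)) with n≡2*⌊n/2⌋+parity n
... | i , bit , n≡ =
  i , bit , trans (cong (λ k → suc (suc k)) n≡) (cong (λ k → suc k + i) (sym (+-suc ⌊ n /2⌋ (⌊ n /2⌋ + 0))))

∣n∣b≡0⇒n≡0 : ∀ n → ∣ n ∣b ≡ 0 → n ≡ 0
∣n∣b≡0⇒n≡0 zero    _ = refl
∣n∣b≡0⇒n≡0 (suc n) ∣n∣≡0 with ≤-trans (⌈log₂⌉-mono-≤ {2} {suc (suc n)} (s≤s (s≤s z≤n))) (≤-reflexive ∣n∣≡0)
... | ()

∣⌊n/2⌋∣b≡∣n∣b∸1 : ∀ n → ∣ ⌊ n /2⌋ ∣b ≡ ∣ n ∣b ∸ 1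
∣⌊n/2⌋∣b≡∣n∣b∸1 n = ⌈log₂⌈n/2⌉⌉≡⌈log₂n⌉∸1 (suc n)

≢0-resp-∣∣b : ∀ {z z'} → z ≢ 0 → ∣ z ∣b ≡ ∣ z' ∣b → z' ≢ 0
≢0-resp-∣∣b {z} z≢0 ∣z∣≡∣z'∣ refl = z≢0 (∣n∣b≡0⇒n≡0 z ∣z∣≡∣z'∣)

∣∣b-halve : ∀ {y i z z'} → (i ≡ 0 ⊎ i ≡ 1) → z ≡ 2 * y + i → z ≢ 0 → ∣ z ∣b ≡ ∣ z' ∣b →
            ∃₂ λ i' y' → (i' ≡ 0 ⊎ i' ≡ 1) × z' ≡ 2 * y' + i' × z' ≢ 0 × ∣ y ∣b ≡ ∣ y' ∣b
∣∣b-halve {y} {z = z} {z'} bit refl z≢0 ∣z∣≡∣z'∣ with n≡2*⌊n/2⌋+parity z'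
... | i' , bit' , z'≡ = i' , ⌊ z' /2⌋ , bit' , z'≡ , ≢0-resp-∣∣b z≢0 ∣z∣≡∣z'∣ , ∣y∣≡∣⌊z'/2⌋∣
  where
  open ≡-Reasoning
  ∣y∣≡∣⌊z'/2⌋∣ : ∣ y ∣b ≡ ∣ ⌊ z' /2⌋ ∣b
  ∣y∣≡∣⌊z'/2⌋∣ = begin
    ∣ y ∣b           ≡⟨ cong ∣_∣b (sym (⌊2*n+i/2⌋≡n y bit)) ⟩
    ∣ ⌊ z /2⌋ ∣b     ≡⟨ ∣⌊n/2⌋∣b≡∣n∣b∸1 z ⟩
    ∣ z ∣b ∸ 1       ≡⟨ cong (_∸ 1) ∣z∣≡∣z'∣ ⟩
    ∣ z' ∣b ∸ 1      ≡⟨ sym (∣⌊n/2⌋∣b≡∣n∣b∸1 z') ⟩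
    ∣ ⌊ z' /2⌋ ∣b    ∎

SameLen-∷ʳ : ∀ {k} {xs xs' : Vec ℕ k} {x x'} →
             SameLen xs xs' → ∣ x ∣b ≡ ∣ x' ∣b → SameLen (xs ∷ʳ x) (xs' ∷ʳ x')
SameLen-∷ʳ {xs = xs} {xs'} {x} {x'} same ∣x∣≡∣x'∣ = begin
  map ∣_∣b (xs ∷ʳ x)            ≡⟨ map-∷ʳ ∣_∣b x xs ⟩
  map ∣_∣b xs ∷ʳ ∣ x ∣b         ≡⟨ cong₂ _∷ʳ_ same ∣x∣≡∣x'∣ ⟩
  map ∣_∣b xs' ∷ʳ ∣ x' ∣b       ≡⟨ map-∷ʳ ∣_∣b x' xs' ⟨
  map ∣_∣b (xs' ∷ʳ x')          ∎
  where open ≡-Reasoning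

SameLen-∷ʳ⁻ : ∀ {k} {xs xs' : Vec ℕ k} {x x'} →
              SameLen (xs ∷ʳ x) (xs' ∷ʳ x') → SameLen xs xs' × ∣ x ∣b ≡ ∣ x' ∣b
SameLen-∷ʳ⁻ {xs = xs} {xs'} {x} {x'} same = ∷ʳ-injective (map ∣_∣b xs) (map ∣_∣b xs')
  (trans (sym (map-∷ʳ ∣_∣b x xs)) (trans same (map-∷ʳ ∣_∣b x' xs')))

map-swap : ∀ {k} {X Y : Set} (f : X → Y) (i j : Fin k) (v : Vec X k) →
           map f (swap i j v) ≡ swap i j (map f v)
map-swap f i j v = begin
  map f ((v [ i ]≔ lookup v j) [ j ]≔ lookup v i)       ≡⟨ map-[]≔ f (v [ i ]≔ lookup v j) j ⟩
  map f (v [ i ]≔ lookup v j) [ j ]≔ f (lookup v i)     ≡⟨ cong (_[ j ]≔ f (lookup v i)) (map-[]≔ f v i) ⟩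
  (map f v [ i ]≔ f (lookup v j)) [ j ]≔ f (lookup v i) ≡⟨ cong₂ (λ a b → (map f v [ i ]≔ a) [ j ]≔ b)
                                                                  (lookup-map j f v) (lookup-map i f v) ⟨
  swap i j (map f v)                                    ∎
  where open ≡-Reasoning

SameLen-swap : ∀ {k} (i j : Fin k) {xs xs' : Vec ℕ k} → SameLen xs xs' → SameLen (swap i j xs) (swap i j xs')
SameLen-swap i j {xs} {xs'} same =
  trans (map-swap ∣_∣b i j xs) (trans (cong (swap i j) same) (sym (map-swap ∣_∣b i j xs')))

module _ (S : System) where

  AllowedFrom : ∀ {m n A} → Pt S m n A → Set
  AllowedFrom p = ∀ {m' n' A'} {r : Pt S m' n' A'} → Reach S (pack S p) (pack S r) → Allowed (step S r)

  AllowedFrom⇒Allowed : ∀ {m n A} {p : Pt S m n A} {R} → step S p ≡ R → AllowedFrom p → Allowed R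
  AllowedFrom⇒Allowed refl allowed = allowed here

  AllowedFrom-premise : ∀ {m n A m₀ n₀ A₀} {p : Pt S m n A} {p₀ : Pt S m₀ n₀ A₀} {R} →
                        step S p ≡ R → pack S p₀ ∈ premises S R → AllowedFrom p → AllowedFrom p₀
  AllowedFrom-premise refl p₀∈ allowed reach = allowed (there p₀∈ reach)

  private
    first : ∀ {q : Node S} {qs} → q ∈ q ∷ qs
    first = here refl

    second : ∀ {q r : Node S} {qs} → r ∈ q ∷ r ∷ qs
    second = there first

  Sem-resp-SameLen : ∀ {m n A} {p : Pt S m n A} {xs ys v} → AllowedFrom p → Sem S p xs ys v →
                     ∀ xs' ys' → SameLen xs xs' → SameLen ys ys' → Sem S p xs' ys' v
  Sem-resp-SameLen ok (ev-id eq) _ _ _ _ = ⊥-elim (AllowedFrom⇒Allowed eq ok)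
  Sem-resp-SameLen ok (ev-condN-ε eq _) _ _ _ _ = ⊥-elim (AllowedFrom⇒Allowed eq ok)
  Sem-resp-SameLen ok (ev-condN-0 eq _ _ _) _ _ _ _ = ⊥-elim (AllowedFrom⇒Allowed eq ok)
  Sem-resp-SameLen ok (ev-condN-1 eq _ _ _) _ _ _ _ = ⊥-elim (AllowedFrom⇒Allowed eq ok)
  Sem-resp-SameLen ok (ev-cond□-ε eq _) _ _ _ _ = ⊥-elim (AllowedFrom⇒Allowed eq ok)
  Sem-resp-SameLen ok (ev-cond□-0 eq _ _ _) _ _ _ _ = ⊥-elim (AllowedFrom⇒Allowed eq ok)
  Sem-resp-SameLen ok (ev-cond□-1 eq _ _ _) _ _ _ _ = ⊥-elim (AllowedFrom⇒Allowed eq ok)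
  Sem-resp-SameLen ok (ev-0 eq) [] [] _ _ = ev-0 eq
  Sem-resp-SameLen ok (ev-1 eq) [] [] _ _ = ev-1 eq
  Sem-resp-SameLen ok (ev-cutN eq d₀ d₁) xs' ys' hx hy =
    ev-cutN eq (Sem-resp-SameLen (AllowedFrom-premise eq first ok) d₀ xs' ys' hx hy)
               (Sem-resp-SameLen (AllowedFrom-premise eq second ok) d₁ xs' _ hx (SameLen-∷ʳ hy refl))
  Sem-resp-SameLen ok (ev-cut□ eq d₀ d₁) xs' ys' hx hy =
    ev-cut□ eq (Sem-resp-SameLen (AllowedFrom-premise eq first ok) d₀ xs' ys' hx hy)
               (Sem-resp-SameLen (AllowedFrom-premise eq second ok) d₁ (_ ∷ xs') ys' (cong (_ ∷_) hx) hy)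
  Sem-resp-SameLen ok (ev-wN eq d) xs' ys' hx hy with initLast ys'
  ... | ys'' , _ , refl =
    ev-wN eq (Sem-resp-SameLen (AllowedFrom-premise eq first ok) d xs' ys'' hx (proj₁ (SameLen-∷ʳ⁻ hy)))
  Sem-resp-SameLen ok (ev-w□ eq d) (_ ∷ xs') ys' hx hy =
    ev-w□ eq (Sem-resp-SameLen (AllowedFrom-premise eq first ok) d xs' ys' (proj₂ (∷-injective hx)) hy)
  Sem-resp-SameLen ok (ev-exN {i = i} {j} eq d) xs' ys' hx hy =
    ev-exN eq (Sem-resp-SameLen (AllowedFrom-premise eq first ok) d xs' _ hx (SameLen-swap i j hy))
  Sem-resp-SameLen ok (ev-ex□ {i = i} {j} eq d) xs' ys' hx hy =
    ev-ex□ eq (Sem-resp-SameLen (AllowedFrom-premise eq first ok) d _ ys' (SameLen-swap i j hx) hy)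
  Sem-resp-SameLen ok (ev-□l eq d) (_ ∷ xs') ys' hx hy with ∷-injective hx
  ... | ∣x∣≡∣x'∣ , hx' =
    ev-□l eq (Sem-resp-SameLen (AllowedFrom-premise eq first ok) d xs' _ hx' (SameLen-∷ʳ hy ∣x∣≡∣x'∣))
  Sem-resp-SameLen ok (ev-□r eq d) xs' [] hx _ =
    ev-□r eq (Sem-resp-SameLen (AllowedFrom-premise eq first ok) d xs' [] hx refl)
  Sem-resp-SameLen ok (ev-s0 eq d) xs' ys' hx hy =
    ev-s0 eq (Sem-resp-SameLen (AllowedFrom-premise eq first ok) d xs' ys' hx hy)
  Sem-resp-SameLen ok (ev-s1 eq d) xs' ys' hx hy =
    ev-s1 eq (Sem-resp-SameLen (AllowedFrom-premise eq first ok) d xs' ys' hx hy)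
  Sem-resp-SameLen ok (ev-∣condN∣-ε eq d) xs' ys' hx hy with initLast ys'
  ... | ys'' , z' , refl with SameLen-∷ʳ⁻ hy
  ... | hy' , ∣0∣≡∣z'∣ with ∣n∣b≡0⇒n≡0 z' (sym ∣0∣≡∣z'∣)
  ... | refl = ev-∣condN∣-ε eq (Sem-resp-SameLen (AllowedFrom-premise eq first ok) d xs' ys'' hx hy')
  Sem-resp-SameLen ok (ev-∣condN∣-s {y = y} eq bit z≡ z≢0 d) xs' ys' hx hy with initLast ys'
  ... | ys'' , z' , refl with SameLen-∷ʳ⁻ hy
  ... | hy' , ∣z∣≡∣z'∣ with ∣∣b-halve {y} bit z≡ z≢0 ∣z∣≡∣z'∣
  ... | _ , y' , bit' , z'≡ , z'≢0 , ∣y∣≡∣y'∣ =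
    ev-∣condN∣-s eq bit' z'≡ z'≢0
      (Sem-resp-SameLen (AllowedFrom-premise eq second ok) d xs' (ys'' ∷ʳ y') hx (SameLen-∷ʳ hy' ∣y∣≡∣y'∣))
  Sem-resp-SameLen ok (ev-∣cond□∣-ε eq d) (z' ∷ xs') ys' hx hy with ∷-injective hx
  ... | ∣0∣≡∣z'∣ , hx' with ∣n∣b≡0⇒n≡0 z' (sym ∣0∣≡∣z'∣)
  ... | refl = ev-∣cond□∣-ε eq (Sem-resp-SameLen (AllowedFrom-premise eq first ok) d xs' ys' hx' hy)
  Sem-resp-SameLen ok (ev-∣cond□∣-s {x = y} eq bit z≡ z≢0 d) (z' ∷ xs') ys' hx hy with ∷-injective hx
  ... | ∣z∣≡∣z'∣ , hx' with ∣∣b-halve {y} bit z≡ z≢0 ∣z∣≡∣z'∣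
  ... | _ , y' , bit' , z'≡ , z'≢0 , ∣y∣≡∣y'∣ =
    ev-∣cond□∣-s eq bit' z'≡ z'≢0
      (Sem-resp-SameLen (AllowedFrom-premise eq second ok) d (y' ∷ xs') ys' (cong₂ _∷_ ∣y∣≡∣y'∣ hx') hy)

mainTheorem11 : ∀ {m n A} (D : CD m n A) → NoCondId D →
                  (xs xs' : Vec ℕ m) (ys ys' : Vec ℕ n) →
                  SameLen xs xs' → SameLen ys ys' →
                  (v : ℕ) → ⟦ D ⟧ xs ⨾ ys ≔ v → ⟦ D ⟧ xs' ⨾ ys' ≔ v
mainTheorem11 D noCondId _ xs' _ ys' hx hy _ d = Sem-resp-SameLen (sys D) noCondId d xs' ys' hx hy
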